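{- There is an algorithm (Algorithm MkV) which, given a finite simple graph $G=(V,E)$, a set $S\subseteq V$ and an integer $k\ge 0$, correctly decides whether $S$ is a mutual $k$-visible set of $G$, and runs in time $O\bigl(|S|(|V|+|E|)+|S|^2\bigr)$; in particular the problem is solvable in polynomial time.
   Context: For $X\subseteq V$ and an integer $k\ge 0$, two vertices $u,v\in V$ are $(X,k)$-visible if there exists a shortest $(u,v)$-path in $G$ having at most $k$ internal vertices in $X$. $X$ is a mutual $k$-visible set if every pair of distinct vertices of $X$ is $(X,k)$-visible (in particular, any two vertices of $X$ must be joined by a path). Algorithm MkV: reject if $S$ meets more than one connected component; otherwise, for each $v\in S$, run a breadth-first search from $v$ and then, processing vertices in BFS-layer order, compute for each vertex $w$ the minimum number of vertices of $S\setminus\{v\}$ on a shortest $(v,w)$-path (counting $w$ itself); reject if this value exceeds $k+1$ for some $q\in S\setminus\{v\}$; accept otherwise. -}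

module Defs where

open import Data.Nat using (ℕ; zero; suc; _+_; _*_; _≤_; _≤ᵇ_)
open import Data.Bool using (Bool; true; false; if_then_else_; _∧_; not)
open import Data.Fin using (Fin)
open import Data.Fin.Properties using (_≟_)
open import Data.Maybe using (Maybe; just; nothing)
open import Data.List using (List; []; _∷_; length; filter; map; allFin)
open import Data.Nat.ListAction using (sum)
open import Data.List.Membership.Propositional using (_∈_; _∉_)
open import Data.List.Relation.Unary.Unique.Propositional using (Unique)
open import Data.Product using (Σ; _×_; _,_)
open import Relation.Nullary using (¬_; does)
open import Relation.Binary.PropositionalEquality using (_≡_)
import Data.List.Membership.DecPropositional as DecMem

record Graph : Set where
  field
    n      : ℕ
    adj    : Fin n → List (Fin n)
    sym    : ∀ u v → v ∈ adj u → u ∈ adj v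
    irrefl : ∀ u → u ∉ adj u
    uniq   : ∀ u → Unique (adj u)
open Graph public

-- Sum of the degrees, = 2|E|.
degSum : Graph → ℕ
degSum G = sum (map (λ u → length (adj G u)) (allFin (n G)))

module _ (G : Graph) where
  open DecMem (_≟_ {n = n G}) using (_∈?_)

  data Path : Fin (n G) → Fin (n G) → Set where
    here : ∀ {u} → Path u u
    step : ∀ {u v w} → v ∈ adj G u → Path v w → Path u w

  len : ∀ {u w} → Path u w → ℕ
  len here       = 0
  len (step _ p) = suc (len p)

  internal : ∀ {u w} → Path u w → List (Fin (n G))
  internal here                          = []
  internal (step _ here)                 = []
  internal (step {v = v} _ (step e p))   = v ∷ internal (step e p)

  IsShortest : ∀ {u w} → Path u w → Set
  IsShortest {u} {w} p = ∀ (q : Path u w) → len p ≤ len q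

  countIn : List (Fin (n G)) → List (Fin (n G)) → ℕ
  countIn X xs = length (filter (λ x → x ∈? X) xs)

  Visible : List (Fin (n G)) → ℕ → Fin (n G) → Fin (n G) → Set
  Visible X k u v = Σ (Path u v) λ p → IsShortest p × countIn X (internal p) ≤ k

  MutualKVisible : List (Fin (n G)) → ℕ → Set
  MutualKVisible X k = ∀ u v → u ∈ X → v ∈ X → ¬ (u ≡ v) → Visible X k u v

-- Algorithm MkV, instrumented with a step counter (unit-cost RAM model:
-- each array read/update, list cell visit and comparison costs O(1);
-- one tick is charged per vertex / adjacency-list entry / S-element
-- processed, and n ticks per array initialisation).

module Alg {N : ℕ} (Adj : Fin N → List (Fin N)) where
  V = Fin N

  Arr : Set → Set
  Arr A = V → A

  upd : ∀ {A : Set} → Arr A → V → A → Arr A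
  upd f i a j = if does (j ≟ i) then a else f j

  scanNbrs : ℕ → List V → Arr (Maybe ℕ) → List V → ℕ → Arr (Maybe ℕ) × List V × ℕ
  scanNbrs d [] dist nxt c = dist , nxt , c
  scanNbrs d (w ∷ ws) dist nxt c with dist w
  ... | just _  = scanNbrs d ws dist nxt (suc c)
  ... | nothing = scanNbrs d ws (upd dist w (just (suc d))) (w ∷ nxt) (suc c)

  expand : ℕ → List V → Arr (Maybe ℕ) → List V → ℕ → Arr (Maybe ℕ) × List V × ℕ
  expand d [] dist nxt c = dist , nxt , c
  expand d (u ∷ us) dist nxt c with scanNbrs d (Adj u) dist nxt (suc c)
  ... | dist' , nxt' , c' = expand d us dist' nxt' c'

  -- BFS layer by layer; returns the list of layers (layer i = vertices at
  -- distance i), the distance array, and the cost.  Fuel: at most n layers.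
  layersFrom : ℕ → ℕ → List V → Arr (Maybe ℕ) → ℕ → List (List V) × Arr (Maybe ℕ) × ℕ
  layersFrom zero    d fr       dist c = [] , dist , c
  layersFrom (suc f) d []       dist c = [] , dist , c
  layersFrom (suc f) d (x ∷ xs) dist c with expand d (x ∷ xs) dist [] c
  ... | dist' , nxt , c' with layersFrom f (suc d) nxt dist' c'
  ...   | ls , dist'' , c'' = (x ∷ xs) ∷ ls , dist'' , c''

  bfs : V → List (List V) × Arr (Maybe ℕ) × ℕ
  bfs v = layersFrom (suc N) 0 (v ∷ []) (upd (λ _ → nothing) v (just 0)) N

  minM : Maybe ℕ → Maybe ℕ → Maybe ℕ
  minM nothing  b        = b
  minM (just a) nothing  = just a
  minM (just a) (just b) = just (Data.Nat._⊓_ a b)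
    where import Data.Nat

  bestPred : Arr (Maybe ℕ) → ℕ → Arr (Maybe ℕ) → List V → Maybe ℕ → ℕ → Maybe ℕ × ℕ
  bestPred dist d val [] acc c = acc , c
  bestPred dist d val (u ∷ us) acc c with dist u
  ... | just e  = bestPred dist d val us
                    (if does (Data.Nat._≟_ e d) then minM acc (val u) else acc) (suc c)
    where import Data.Nat
  ... | nothing = bestPred dist d val us acc (suc c)

  -- process one layer whose vertices are at distance suc d;
  -- sv w = 1 if w ∈ S ∖ {v}, else 0
  processLayer : Arr (Maybe ℕ) → (V → ℕ) → ℕ → List V → Arr (Maybe ℕ) → ℕ → Arr (Maybe ℕ) × ℕ
  processLayer dist sv d [] val c = val , c
  processLayer dist sv d (w ∷ ws) val c with bestPred dist d val (Adj w) nothing (suc c)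
  ... | b , c' = processLayer dist sv d ws (upd val w (Data.Maybe.map (λ x → x + sv w) b)) c'
    where import Data.Maybe

  processLayers : Arr (Maybe ℕ) → (V → ℕ) → ℕ → List (List V) → Arr (Maybe ℕ) → ℕ → Arr (Maybe ℕ) × ℕ
  processLayers dist sv d [] val c = val , c
  processLayers dist sv d (l ∷ ls) val c with processLayer dist sv d l val c
  ... | val' , c' = processLayers dist sv (suc d) ls val' c'

  inSArr : List V → Arr Bool × ℕ
  inSArr []       = (λ _ → false) , N
  inSArr (s ∷ ss) with inSArr ss
  ... | a , c = upd a s true , suc c

  -- check every q ∈ S ∖ {v} has value ≤ k+1 (nothing = unreachable: reject)
  checkVals : V → ℕ → Arr (Maybe ℕ) → List V → ℕ → Bool × ℕ
  checkVals v k val [] c = true , c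
  checkVals v k val (q ∷ qs) c with checkVals v k val qs (suc c)
  ... | b , c' = (if does (q ≟ v) then b
                  else (ok (val q) ∧ b)) , c'
    where
    ok : Maybe ℕ → Bool
    ok nothing  = false
    ok (just x) = x ≤ᵇ suc k

  fromVertex : Arr Bool → List V → ℕ → V → Bool × ℕ
  fromVertex inS S k v = go (bfs v)
    where
    sv : V → ℕ
    sv w = if inS w ∧ not (does (w ≟ v)) then 1 else 0
    go : List (List V) × Arr (Maybe ℕ) × ℕ → Bool × ℕ
    go ([] , dist , c) = true , c
    go ((_ ∷ ls) , dist , c) with processLayers dist sv 0 ls
                                   (upd (λ _ → nothing) v (just 0)) (c + N)
    ... | val , c' = checkVals v k val S c'

  allFrom : Arr Bool → List V → ℕ → List V → Bool × ℕ
  allFrom inS S k [] = true , 0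
  allFrom inS S k (v ∷ vs) with fromVertex inS S k v | allFrom inS S k vs
  ... | b , c | b' , c' = (b ∧ b') , c + c'

  -- component check: every element of S is reached by a BFS from s0
  allReached : Arr (Maybe ℕ) → List V → ℕ → Bool × ℕ
  allReached dist [] c = true , c
  allReached dist (q ∷ qs) c with allReached dist qs (suc c)
  ... | b , c' = (reached (dist q) ∧ b) , c'
    where
    reached : Maybe ℕ → Bool
    reached nothing  = false
    reached (just _) = true

  mkv : List V → ℕ → Bool × ℕ
  mkv [] k = true , 0
  mkv (s0 ∷ ss) k with bfs s0
  ... | _ , dist , c0 with allReached dist (s0 ∷ ss) c0
  ...   | false , c1 = false , c1
  ...   | true  , c1 with inSArr (s0 ∷ ss)
  ...     | inS , c2 with allFrom inS (s0 ∷ ss) k (s0 ∷ ss)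
  ...       | b , c3 = b , (c1 + c2 + c3)

MkV : (G : Graph) → List (Fin (n G)) → ℕ → Bool × ℕ
MkV G = Alg.mkv (adj G)

{-# OPTIONS --safe #-}
-- Fix a source v.  The breadth-first search of MkV labels every vertex with its distance from v
-- and returns the distance classes as layers.  Sweeping these layers in order, a vertex w at
-- distance d + 1 receives the least value among its neighbours at distance d, plus one if w lies
-- in S ∖ {v}; by induction on d this is the least number of vertices of S ∖ {v} after v on a
-- shortest (v, w)-path.  A shortest path never returns to v, so for q ∈ S ∖ {v} this number
-- exceeds by one the number of internal vertices of the path lying in S, and comparing it with
-- k + 1 decides whether v and q are (S, k)-visible.
-- Each vertex costs 1 + deg once in the search and once in the sweep.  For the search this is
-- amortised: the work done so far plus the weights 1 + deg of all unmarked and all frontier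
-- vertices never increases, and it starts at n + degSum.  So one source costs
-- O(n + degSum + |S|), and MkV costs O(|S| (n + degSum) + |S|²).
module Submission where

open import Defs hiding (sym)

open import Data.Bool using (T; true; false; if_then_else_; _∧_; not)
open import Data.Bool.Properties using (T-∧)
open import Data.Empty using (⊥-elim)
open import Data.Fin using (Fin) renaming (zero to fzero; suc to fsuc; _<_ to _<ᶠ_)
open import Data.Fin.Properties using (_≟_; pigeonhole) renaming (suc-injective to fsuc-injective)
open import Data.List using (List; []; _∷_; length; map; tabulate; drop)
open import Data.List.Properties using (tabulate-cong; map-tabulate)
open import Data.List.Membership.Propositional using (_∈_; _∉_)
import Data.List.Membership.DecPropositional as DecMem
open import Data.List.Relation.Unary.Any using (here; there)
open import Data.List.Relation.Unary.Unique.Propositional using (Unique)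
open import Data.Maybe using (Maybe; just; nothing; maybe′)
import Data.Maybe as Maybe
open import Data.Maybe.Properties using (just-injective)
open import Data.Maybe.Relation.Unary.Any using (just) renaming (Any to MaybeAny)
open import Data.Nat using (ℕ; zero; suc; _+_; _*_; _≤_; _<_; z≤n; s≤s; _≤?_; _<?_; _≡ᵇ_)
open import Data.Nat.ListAction using (sum)
open import Data.Nat.Properties hiding (_≟_)
open import Algebra.Properties.CommutativeSemigroup +-commutativeSemigroup using (x∙yz≈y∙xz; xy∙z≈xz∙y)
open import Data.Nat.Solver using (module +-*-Solver)
open +-*-Solver using (solve; _:=_; con; _:+_; _:*_)
open import Data.Product using (Σ; _×_; _,_; proj₁; proj₂)
open import Data.Sum using (_⊎_; inj₁; inj₂)
import Data.Sum as Sum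
open import Function using (_∘_; id)
open import Function.Bundles using (_⇔_; mk⇔; Equivalence)
open import Relation.Binary.PropositionalEquality
  using (_≡_; _≢_; refl; sym; trans; cong; cong₂; subst; subst₂; module ≡-Reasoning)
open import Relation.Nullary using (¬_; yes; no; does)

sum-tabulate-suc : ∀ {m} (f : Fin m → ℕ) → sum (tabulate (suc ∘ f)) ≡ m + sum (tabulate f)
sum-tabulate-suc {zero}  f = refl
sum-tabulate-suc {suc m} f = cong suc (begin
  f fzero + sum (tabulate (suc ∘ f ∘ fsuc)) ≡⟨ cong (f fzero +_) (sum-tabulate-suc (f ∘ fsuc)) ⟩
  f fzero + (m + sum (tabulate (f ∘ fsuc))) ≡⟨ x∙yz≈y∙xz (f fzero) m _ ⟩
  m + (f fzero + sum (tabulate (f ∘ fsuc))) ∎)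
  where open ≡-Reasoning

sum-tabulate-erase : ∀ {m} (f g : Fin m → ℕ) i → (∀ j → j ≢ i → g j ≡ f j) → g i ≡ 0 →
                     sum (tabulate g) + f i ≡ sum (tabulate f)
sum-tabulate-erase {suc m} f g fzero g≡f gᵢ≡0 = begin
  g fzero + sum (tabulate (g ∘ fsuc)) + f fzero  ≡⟨ cong (λ z → z + sum (tabulate (g ∘ fsuc)) + f fzero) gᵢ≡0 ⟩
  sum (tabulate (g ∘ fsuc)) + f fzero            ≡⟨ +-comm _ (f fzero) ⟩
  f fzero + sum (tabulate (g ∘ fsuc))            ≡⟨ cong (λ xs → f fzero + sum xs) (tabulate-cong g≗f) ⟩
  f fzero + sum (tabulate (f ∘ fsuc))            ∎
  where
  open ≡-Reasoning
  g≗f : ∀ j → g (fsuc j) ≡ f (fsuc j)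
  g≗f j = g≡f (fsuc j) λ ()
sum-tabulate-erase {suc m} f g (fsuc i) g≡f gᵢ≡0 = begin
  g fzero + sum (tabulate (g ∘ fsuc)) + f (fsuc i)    ≡⟨ +-assoc (g fzero) _ _ ⟩
  g fzero + (sum (tabulate (g ∘ fsuc)) + f (fsuc i))  ≡⟨ cong₂ _+_ (g≡f fzero λ ()) rest ⟩
  f fzero + sum (tabulate (f ∘ fsuc))                 ∎
  where
  open ≡-Reasoning
  rest = sum-tabulate-erase (f ∘ fsuc) (g ∘ fsuc) i (λ j j≢i → g≡f (fsuc j) (j≢i ∘ fsuc-injective)) gᵢ≡0

suc-+-assoc : ∀ c a b → suc c + a + b ≡ c + (suc a + b)
suc-+-assoc c a b = trans (cong (_+ b) (sym (+-suc c a))) (+-assoc c (suc a) b)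

cost-arithmetic : ∀ N D s′ → let s = suc s′ in
  N + (N + D) + s + (N + s) + s * (N + (N + D) + N + (N + D) + s) ≤ 7 * (s * (N + D) + s * s)
cost-arithmetic N D s′ = ≤-trans (m≤m+n _ _) (≤-reflexive (slack N D s′))
  where
  -- the slack is the difference of the two sides, a polynomial with nonnegative coefficients
  slack : ∀ N D s′ → let s = suc s′ in
    N + (N + D) + s + (N + s) + s * (N + (N + D) + N + (N + D) + s)
      + (3 * N * s′ + 4 * D + 5 * D * s′ + 6 * s′ * s′ + 10 * s′ + 4)
      ≡ 7 * (s * (N + D) + s * s)
  slack = solve 3 (λ N D s′ → let s = con 1 :+ s′ in
    N :+ (N :+ D) :+ s :+ (N :+ s) :+ s :* (N :+ (N :+ D) :+ N :+ (N :+ D) :+ s)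
      :+ (con 3 :* N :* s′ :+ con 4 :* D :+ con 5 :* D :* s′ :+ con 6 :* s′ :* s′ :+ con 10 :* s′ :+ con 4)
    := con 7 :* (s :* (N :+ D) :+ s :* s)) refl

module _ (G : Graph) where
  open Alg (adj G)

  private variable
    u w x : V

  Labels : Set
  Labels = Arr (Maybe ℕ)

  sourceLabels : V → Labels
  sourceLabels v = upd (λ _ → nothing) v (just 0)

  -- Walks and distances

  infixl 5 _∷ʳ_
  _∷ʳ_ : Path G u x → w ∈ adj G x → Path G u w
  here       ∷ʳ e = step e here
  step e′ p ∷ʳ e = step e′ (p ∷ʳ e)

  len-∷ʳ : (p : Path G u x) (e : w ∈ adj G x) → len G (p ∷ʳ e) ≡ suc (len G p)
  len-∷ʳ here       e = refl
  len-∷ʳ (step _ p) e = cong suc (len-∷ʳ p e)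

  data SnocView {u} : ∀ {w} → Path G u w → Set where
    empty : SnocView here
    snoc  : (p : Path G u x) (e : w ∈ adj G x) → SnocView (p ∷ʳ e)

  snocView : (p : Path G u w) → SnocView p
  snocView here = empty
  snocView (step e p) with snocView p
  ... | empty    = snoc here e
  ... | snoc q f = snoc (step e q) f

  shortest-init : (p : Path G u x) (e : w ∈ adj G x) → IsShortest G (p ∷ʳ e) → IsShortest G p
  shortest-init p e sh q = ≤-pred (subst₂ _≤_ (len-∷ʳ p e) (len-∷ʳ q e) (sh (q ∷ʳ e)))

  vertexAt : (p : Path G u w) → Fin (suc (len G p)) → V
  vertexAt {u} p          fzero    = u
  vertexAt     (step e p) (fsuc i) = vertexAt p i

  suffixAt : (p : Path G u w) (i : Fin (suc (len G p))) → Σ (Path G (vertexAt p i) w) λ q → len G q ≤ len G p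
  suffixAt p          fzero    = p , ≤-refl
  suffixAt (step e p) (fsuc i) with suffixAt p i
  ... | q , q≤p = q , m≤n⇒m≤1+n q≤p

  shortcut : (p : Path G u w) (i j : Fin (suc (len G p))) → i <ᶠ j → vertexAt p i ≡ vertexAt p j →
             Σ (Path G u w) λ q → len G q < len G p
  shortcut (step e p) fzero    (fsuc j) _         refl with suffixAt p j
  ... | q , q≤p = q , s≤s q≤p
  shortcut (step e p) (fsuc i) (fsuc j) (s≤s i<j) pᵢ≡pⱼ with shortcut p i j i<j pᵢ≡pⱼ
  ... | q , q<p = step e q , s≤s q<p

  shortest-simple : (p : Path G u w) → IsShortest G p → ∀ i j → i <ᶠ j → vertexAt p i ≢ vertexAt p j
  shortest-simple p sh i j i<j pᵢ≡pⱼ with shortcut p i j i<j pᵢ≡pⱼ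
  ... | q , q<p = <⇒≱ q<p (sh q)

  shortest-len< : (p : Path G u w) → IsShortest G p → len G p < n G
  shortest-len< p sh with len G p <? n G
  ... | yes p<n = p<n
  ... | no  p≮n with pigeonhole (s≤s (≮⇒≥ p≮n)) (vertexAt p)
  ...   | i , j , i<j , pᵢ≡pⱼ = ⊥-elim (shortest-simple p sh i j i<j pᵢ≡pⱼ)

  tally : (V → ℕ) → Path G u w → ℕ
  tally χ here               = 0
  tally χ (step {v = x} _ p) = χ x + tally χ p

  tally-∷ʳ : ∀ χ (p : Path G u x) (e : w ∈ adj G x) → tally χ (p ∷ʳ e) ≡ tally χ p + χ w
  tally-∷ʳ {w = w} χ here e = +-identityʳ (χ w)
  tally-∷ʳ χ (step {v = y} _ p) e = trans (cong (χ y +_) (tally-∷ʳ χ p e)) (sym (+-assoc (χ y) _ _))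

  module Distances (v : V) where

    IsDist : V → ℕ → Set
    IsDist w d = Σ (Path G v w) λ p → IsShortest G p × len G p ≡ d

    dist-unique : ∀ {d d′} → IsDist w d → IsDist w d′ → d ≡ d′
    dist-unique (p , sp , refl) (q , sq , refl) = ≤-antisym (sp q) (sq p)

    dist-source : IsDist v 0
    dist-source = here , (λ _ → z≤n) , refl

    dist0⇒≡v : IsDist w 0 → w ≡ v
    dist0⇒≡v (here , _ , _) = refl

    dist<n : ∀ {d} → IsDist w d → d < n G
    dist<n (p , sp , refl) = shortest-len< p sp

    dist-pred : ∀ {d} → IsDist w (suc d) → Σ V λ u → IsDist u d × w ∈ adj G u
    dist-pred (p , sp , lp) with snocView p
    dist-pred (.(q ∷ʳ e) , sp , lp) | snoc q e =
      _ , (q , shortest-init q e sp , suc-injective (trans (sym (len-∷ʳ q e)) lp)) , e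

    dist-downClosed : ∀ {d d′} → IsDist w d → d′ ≤ d → Σ V λ u → IsDist u d′
    dist-downClosed {w} {d} {d′} dw d′≤d with m≤n⇒m<n∨m≡n d′≤d
    ... | inj₂ refl = w , dw
    dist-downClosed {d = suc d} dw _ | inj₁ (s≤s d′≤d) with dist-pred dw
    ... | u , du , _ = dist-downClosed du d′≤d

    dist-shortest : ∀ {d} → IsDist w d → (p : Path G v w) → len G p ≡ d → IsShortest G p
    dist-shortest (q , sq , refl) p p≡q r = subst (_≤ len G r) (sym p≡q) (sq r)

    dist-∷ʳ : ∀ {d} → IsDist u d → w ∈ adj G u → (∀ (q : Path G v w) → d < len G q) → IsDist w (suc d)
    dist-∷ʳ (p , sp , refl) e far =
      p ∷ʳ e , (λ q → subst (_≤ len G q) (sym (len-∷ʳ p e)) (far q)) , len-∷ʳ p e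

    IsDistLayer : ℕ → List V → Set
    IsDistLayer d l = ∀ w → (w ∈ l → IsDist w d) × (IsDist w d → w ∈ l)

    Exhausted : ℕ → Set
    Exhausted d = ∀ w x → d ≤ x → ¬ IsDist w x

    Layers : ℕ → List (List V) → Set
    Layers d []       = Exhausted d
    Layers d (l ∷ ls) = IsDistLayer d l × Layers (suc d) ls

    Exact : Labels → Set
    Exact dist = ∀ w x → (dist w ≡ just x → IsDist w x) × (IsDist w x → dist w ≡ just x)

  -- Breadth-first search

  upd-≡ : ∀ {A : Set} (f : Arr A) i a → upd f i a i ≡ a
  upd-≡ f i a with i ≟ i
  ... | yes _   = refl
  ... | no  i≢i = ⊥-elim (i≢i refl)

  upd-≢ : ∀ {A : Set} (f : Arr A) i a j → j ≢ i → upd f i a j ≡ f j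
  upd-≢ f i a j j≢i with j ≟ i
  ... | yes j≡i = ⊥-elim (j≢i j≡i)
  ... | no  _   = refl

  just≢nothing : ∀ {x : ℕ} → just x ≢ nothing
  just≢nothing ()

  Marked : Labels → V → Set
  Marked dist w = Σ ℕ λ d → dist w ≡ just d

  IsLabelLayer : ℕ → Labels → List V → Set
  IsLabelLayer d dist l = ∀ w → (w ∈ l → dist w ≡ just d) × (dist w ≡ just d → w ∈ l)

  _⊑_ : Labels → Labels → Set
  old ⊑ new = ∀ w x → old w ≡ just x → new w ≡ just x

  record Extends (d : ℕ) (Q : V → Set) (old new : Labels) : Set where
    field
      keeps : old ⊑ new
      fresh : ∀ w x → new w ≡ just x → old w ≡ just x ⊎ (old w ≡ nothing × x ≡ d × Q w)
  open Extends

  PreservedByMarking : ℕ → (V → Set) → (Labels → List V → Set) → Set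
  PreservedByMarking d Q P =
    ∀ {w} dist nxt → Q w → dist w ≡ nothing → P dist nxt → P (upd dist w (just d)) (w ∷ nxt)

  scanNbrs-preserves : ∀ {Q P} d ws dist nxt c → (∀ {w} → w ∈ ws → Q w) → PreservedByMarking (suc d) Q P →
                       P dist nxt → let r = scanNbrs d ws dist nxt c in P (proj₁ r) (proj₁ (proj₂ r))
  scanNbrs-preserves d []       dist nxt c inQ mark P₀ = P₀
  scanNbrs-preserves {P = P} d (w ∷ ws) dist nxt c inQ mark P₀ with dist w in eq
  ... | just _  = scanNbrs-preserves {P = P} d ws dist nxt (suc c) (inQ ∘ there) mark P₀
  ... | nothing = scanNbrs-preserves {P = P} d ws _ _ (suc c) (inQ ∘ there) mark (mark dist nxt (inQ (here refl)) eq P₀)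

  NeighbourOf : List V → V → Set
  NeighbourOf us w = Σ V λ u → u ∈ us × w ∈ adj G u

  expand-preserves : ∀ {P} d us dist nxt c → PreservedByMarking (suc d) (NeighbourOf us) P →
                     P dist nxt → let r = expand d us dist nxt c in P (proj₁ r) (proj₁ (proj₂ r))
  expand-preserves d []       dist nxt c mark P₀ = P₀
  expand-preserves {P} d (u ∷ us) dist nxt c mark P₀ =
    expand-preserves {P} d us _ _ _ (λ { dist′ nxt′ (u′ , u′∈ , w∈) → mark dist′ nxt′ (u′ , there u′∈ , w∈) })
      (scanNbrs-preserves {P = P} d (adj G u) dist nxt (suc c) (λ w∈ → u , here refl , w∈) mark P₀)

  IsLabelLayer-mark : ∀ {d Q} → PreservedByMarking d Q (IsLabelLayer d)
  IsLabelLayer-mark {w = w} _ _ _ _ layer y with y ≟ w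
  ... | yes refl = (λ _ → refl) , (λ _ → here refl)
  ... | no  y≢w  = (λ { (here y≡w) → ⊥-elim (y≢w y≡w) ; (there y∈) → proj₁ (layer y) y∈ })
                 , (λ eq → there (proj₂ (layer y) eq))

  ⊑-mark : ∀ {d Q old} → PreservedByMarking d Q (λ dist _ → old ⊑ dist)
  ⊑-mark {w = w} _ _ _ unmarked old⊑dist y x eq with y ≟ w
  ... | yes refl = ⊥-elim (just≢nothing (trans (sym (old⊑dist y x eq)) unmarked))
  ... | no  _    = old⊑dist y x eq

  Extends-mark : ∀ {d Q old} → PreservedByMarking d Q (λ dist _ → Extends d Q old dist)
  Extends-mark {d} {Q} {old} {w} dist nxt qw unmarked ext = record
    { keeps = ⊑-mark {Q = Q} dist nxt qw unmarked (keeps ext) ; fresh = fresh′ }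
    where
    fresh′ : ∀ y x → upd dist w (just d) y ≡ just x → old y ≡ just x ⊎ (old y ≡ nothing × x ≡ d × Q y)
    fresh′ y x eq with y ≟ w
    ... | no  _    = fresh ext y x eq
    ... | yes refl with old y in old-y
    ...   | just z  = ⊥-elim (just≢nothing (trans (sym (keeps ext y z old-y)) unmarked))
    ...   | nothing = inj₂ (refl , just-injective (sym eq) , qw)

  Extends-refl : ∀ {d Q dist} → Extends d Q dist dist
  Extends-refl = record { keeps = λ _ _ eq → eq ; fresh = λ _ _ eq → inj₁ eq }

  deg : V → ℕ
  deg w = length (adj G w)

  weight : V → ℕ
  weight w = suc (deg w)

  weights : List V → ℕ
  weights us = sum (map weight us)

  layersWeight : List (List V) → ℕ
  layersWeight ls = sum (map weights ls)

  unmarkedWeight : Labels → ℕ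
  unmarkedWeight dist = sum (tabulate λ w → maybe′ (λ _ → 0) (weight w) (dist w))

  unmarkedWeight-mark : ∀ dist w d → dist w ≡ nothing →
                        unmarkedWeight (upd dist w (just d)) + weight w ≡ unmarkedWeight dist
  unmarkedWeight-mark dist w d unmarked =
    subst (λ mw → unmarkedWeight (upd dist w (just d)) + maybe′ (λ _ → 0) (weight w) mw ≡ unmarkedWeight dist)
      unmarked
      (sum-tabulate-erase _ _ w (λ j j≢w → cong (maybe′ (λ _ → 0) (weight j)) (upd-≢ dist w (just d) j j≢w))
                                (cong (maybe′ (λ _ → 0) (weight w)) (upd-≡ dist w (just d))))

  unmarkedWeight-unmarked : unmarkedWeight (λ _ → nothing) ≡ n G + degSum G
  unmarkedWeight-unmarked = trans (sum-tabulate-suc deg) (cong (λ ds → n G + sum ds) (sym (map-tabulate id deg)))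

  potential-mark : ∀ {d Q K} → PreservedByMarking d Q (λ dist nxt → unmarkedWeight dist + weights nxt ≡ K)
  potential-mark {d} {w = w} dist nxt _ unmarked potential = begin
    unmarkedWeight (upd dist w (just d)) + (weight w + weights nxt)  ≡⟨ +-assoc _ (weight w) _ ⟨
    unmarkedWeight (upd dist w (just d)) + weight w + weights nxt    ≡⟨ cong (_+ weights nxt) marking ⟩
    unmarkedWeight dist + weights nxt                                ≡⟨ potential ⟩
    _                                                                ∎
    where
    open ≡-Reasoning
    marking = unmarkedWeight-mark dist w d unmarked

  module _ (d : ℕ) where

    expand-layer : ∀ us dist nxt c → IsLabelLayer (suc d) dist nxt →
                   let r = expand d us dist nxt c in IsLabelLayer (suc d) (proj₁ r) (proj₁ (proj₂ r))
    expand-layer us dist nxt c =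
      expand-preserves {IsLabelLayer (suc d)} d us dist nxt c (IsLabelLayer-mark {Q = NeighbourOf us})

    expand-extends : ∀ us dist nxt c → Extends (suc d) (NeighbourOf us) dist (proj₁ (expand d us dist nxt c))
    expand-extends us dist nxt c =
      expand-preserves {λ new _ → Extends (suc d) (NeighbourOf us) dist new} d us dist nxt c Extends-mark Extends-refl

    expand-potential : ∀ us dist nxt c → let r = expand d us dist nxt c in
                       unmarkedWeight (proj₁ r) + weights (proj₁ (proj₂ r)) ≡ unmarkedWeight dist + weights nxt
    expand-potential us dist nxt c =
      expand-preserves {λ dist′ nxt′ → unmarkedWeight dist′ + weights nxt′ ≡ unmarkedWeight dist + weights nxt}
                       d us dist nxt c (potential-mark {Q = NeighbourOf us}) refl

    scanNbrs-⊑ : ∀ ws dist nxt c → dist ⊑ proj₁ (scanNbrs d ws dist nxt c)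
    scanNbrs-⊑ ws dist nxt c =
      scanNbrs-preserves {Q = _∈ ws} {P = λ new _ → dist ⊑ new} d ws dist nxt c id (⊑-mark {Q = _∈ ws}) (λ _ _ eq → eq)

    scanNbrs-covers : ∀ ws dist nxt c → w ∈ ws → Marked (proj₁ (scanNbrs d ws dist nxt c)) w
    scanNbrs-covers (w ∷ ws) dist nxt c w∈ with dist w in eq | w∈
    ... | just x  | here refl  = x , scanNbrs-⊑ ws dist nxt (suc c) w x eq
    ... | nothing | here refl  = suc d , scanNbrs-⊑ ws _ _ (suc c) w (suc d) (upd-≡ dist w _)
    ... | just _  | there w∈ws = scanNbrs-covers ws _ _ (suc c) w∈ws
    ... | nothing | there w∈ws = scanNbrs-covers ws _ _ (suc c) w∈ws

    expand-covers : ∀ us dist nxt c → ∀ {u} → u ∈ us → w ∈ adj G u → Marked (proj₁ (expand d us dist nxt c)) w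
    expand-covers (u ∷ us) dist nxt c (here refl) w∈ with scanNbrs-covers (adj G u) dist nxt (suc c) w∈
    ... | x , eq = x , keeps (expand-extends us _ _ _) _ x eq
    expand-covers (u ∷ us) dist nxt c (there u∈us) w∈ = expand-covers us _ _ _ u∈us w∈

    scanNbrs-cost : ∀ ws dist nxt c → proj₂ (proj₂ (scanNbrs d ws dist nxt c)) ≡ c + length ws
    scanNbrs-cost []       dist nxt c = sym (+-identityʳ c)
    scanNbrs-cost (w ∷ ws) dist nxt c with dist w
    ... | just _  = trans (scanNbrs-cost ws _ _ (suc c)) (sym (+-suc c _))
    ... | nothing = trans (scanNbrs-cost ws _ _ (suc c)) (sym (+-suc c _))

    expand-cost : ∀ us dist nxt c → proj₂ (proj₂ (expand d us dist nxt c)) ≡ c + weights us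
    expand-cost []       dist nxt c = sym (+-identityʳ c)
    expand-cost (u ∷ us) dist nxt c = begin
      proj₂ (proj₂ (expand d us _ _ _))  ≡⟨ expand-cost us _ _ _ ⟩
      _ + weights us                     ≡⟨ cong (_+ weights us) (scanNbrs-cost (adj G u) dist nxt (suc c)) ⟩
      suc c + deg u + weights us         ≡⟨ suc-+-assoc c (deg u) _ ⟩
      c + weights (u ∷ us)               ∎
      where open ≡-Reasoning

  layersFrom-cost : ∀ f d fr dist c → let r = layersFrom f d fr dist c in
                    proj₂ (proj₂ r) ≡ c + layersWeight (proj₁ r)
  layersFrom-cost zero    d fr       dist c = sym (+-identityʳ c)
  layersFrom-cost (suc f) d []       dist c = sym (+-identityʳ c)
  layersFrom-cost (suc f) d (x ∷ xs) dist c =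
    trans (layersFrom-cost f (suc d) (proj₁ (proj₂ r)) (proj₁ r) (proj₂ (proj₂ r)))
          (trans (cong (_+ rest) (expand-cost d (x ∷ xs) dist [] c)) (+-assoc c _ rest))
    where
    r = expand d (x ∷ xs) dist [] c
    rest = layersWeight (proj₁ (layersFrom f (suc d) (proj₁ (proj₂ r)) (proj₁ r) (proj₂ (proj₂ r))))

  layersFrom-potential : ∀ f d fr dist c → let r = layersFrom f d fr dist c in
                         proj₂ (proj₂ r) + unmarkedWeight (proj₁ (proj₂ r)) ≤ c + unmarkedWeight dist + weights fr
  layersFrom-potential zero    d fr       dist c = m≤m+n _ _
  layersFrom-potential (suc f) d []       dist c = m≤m+n _ _
  layersFrom-potential (suc f) d (x ∷ xs) dist c =
    ≤-trans (layersFrom-potential f (suc d) (proj₁ (proj₂ r)) (proj₁ r) (proj₂ (proj₂ r))) (≤-reflexive (begin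
      proj₂ (proj₂ r) + unmarkedWeight (proj₁ r) + weights (proj₁ (proj₂ r))
        ≡⟨ cong (λ t → t + unmarkedWeight (proj₁ r) + weights (proj₁ (proj₂ r))) (expand-cost d (x ∷ xs) dist [] c) ⟩
      c + weights (x ∷ xs) + unmarkedWeight (proj₁ r) + weights (proj₁ (proj₂ r))
        ≡⟨ +-assoc (c + _) _ _ ⟩
      c + weights (x ∷ xs) + (unmarkedWeight (proj₁ r) + weights (proj₁ (proj₂ r)))
        ≡⟨ cong (c + weights (x ∷ xs) +_) (trans (expand-potential d (x ∷ xs) dist [] c) (+-identityʳ _)) ⟩
      c + weights (x ∷ xs) + unmarkedWeight dist
        ≡⟨ xy∙z≈xz∙y c _ _ ⟩
      c + unmarkedWeight dist + weights (x ∷ xs) ∎))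
    where
    r = expand d (x ∷ xs) dist [] c
    open ≡-Reasoning

  unmarkedWeight-source : ∀ v → unmarkedWeight (sourceLabels v) + weight v ≡ n G + degSum G
  unmarkedWeight-source v = trans (unmarkedWeight-mark _ v 0 refl) unmarkedWeight-unmarked

  bfs-cost : ∀ v → proj₂ (proj₂ (bfs v)) ≤ n G + (n G + degSum G)
  bfs-cost v = begin
    proj₂ (proj₂ (bfs v))                                           ≤⟨ m≤m+n _ _ ⟩
    proj₂ (proj₂ (bfs v)) + unmarkedWeight (proj₁ (proj₂ (bfs v)))  ≤⟨ layersFrom-potential (suc (n G)) 0 (v ∷ []) _ (n G) ⟩
    n G + Φ₀ + (weight v + 0)                                       ≡⟨ cong (n G + Φ₀ +_) (+-identityʳ _) ⟩
    n G + Φ₀ + weight v                                             ≡⟨ +-assoc (n G) _ _ ⟩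
    n G + (Φ₀ + weight v)                                           ≡⟨ cong (n G +_) (unmarkedWeight-source v) ⟩
    n G + (n G + degSum G)                                          ∎
    where
    open ≤-Reasoning
    Φ₀ = unmarkedWeight (sourceLabels v)

  bfs-layersWeight : ∀ v → layersWeight (proj₁ (bfs v)) ≤ n G + degSum G
  bfs-layersWeight v = +-cancelˡ-≤ (n G) _ _
    (subst (_≤ n G + (n G + degSum G)) (layersFrom-cost (suc (n G)) 0 (v ∷ []) (sourceLabels v) (n G)) (bfs-cost v))

  module BFS (v : V) where
    open Distances v

    record Invariant (d : ℕ) (fr : List V) (dist : Labels) : Set where
      field
        frontier : IsLabelLayer d dist fr
        sound    : ∀ w x → dist w ≡ just x → x ≤ d × IsDist w x
        -- stated for all paths rather than shortest ones, so that the existence of shortest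
        -- paths never has to be proved separately
        complete : ∀ {w} (p : Path G v w) → len G p ≤ d → Marked dist w

    module _ {d fr dist} (inv : Invariant d fr dist) where
      open Invariant inv

      Invariant-marks : ∀ {w x} → IsDist w x → x ≤ d → dist w ≡ just x
      Invariant-marks {w} dw@(p , _ , refl) x≤d with complete p x≤d
      ... | y , eq = trans eq (cong just (dist-unique (proj₂ (sound w y eq)) dw))

      Invariant-frontier : IsDistLayer d fr
      Invariant-frontier w = (λ w∈ → proj₂ (sound w d (proj₁ (frontier w) w∈)))
                           , (λ dw → proj₂ (frontier w) (Invariant-marks dw ≤-refl))

      Invariant-exhausted : (∀ w → w ∉ fr) → Exhausted d
      Invariant-exhausted no-fr w x d≤x dw with dist-downClosed dw d≤x
      ... | u , du = no-fr u (proj₂ (Invariant-frontier u) du)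

      Invariant-exact : Exhausted d → Exact dist
      Invariant-exact far w x = (λ eq → proj₂ (sound w x eq)) , marks
        where
        marks : IsDist w x → dist w ≡ just x
        marks dw with x ≤? d
        ... | yes x≤d = Invariant-marks dw x≤d
        ... | no  x≰d = ⊥-elim (far w x (<⇒≤ (≰⇒> x≰d)) dw)

      Invariant-expand : ∀ c → let r = expand d fr dist [] c in Invariant (suc d) (proj₁ (proj₂ r)) (proj₁ r)
      Invariant-expand c = record { frontier = frontier′ ; sound = sound′ ; complete = complete′ }
        where
        r = expand d fr dist [] c
        ext = expand-extends d fr dist [] c

        frontier′ : IsLabelLayer (suc d) (proj₁ r) (proj₁ (proj₂ r))
        frontier′ = expand-layer d fr dist [] c λ w → (λ ()) , λ eq → ⊥-elim (1+n≰n (proj₁ (sound w (suc d) eq)))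

        sound′ : ∀ w x → proj₁ r w ≡ just x → x ≤ suc d × IsDist w x
        sound′ w x eq with fresh ext w x eq
        ... | inj₁ old = m≤n⇒m≤1+n (proj₁ (sound w x old)) , proj₂ (sound w x old)
        ... | inj₂ (unmarked , refl , u , u∈fr , w∈) = ≤-refl , dist-∷ʳ (proj₁ (Invariant-frontier u) u∈fr) w∈ far
          where
          far : ∀ (q : Path G v w) → d < len G q
          far q = ≰⇒> λ q≤d → just≢nothing (trans (sym (proj₂ (complete q q≤d))) unmarked)

        complete′ : ∀ {w} (p : Path G v w) → len G p ≤ suc d → Marked (proj₁ r) w
        complete′ p p≤ with m≤n⇒m<n∨m≡n p≤ | snocView p
        ... | inj₁ (s≤s p≤d) | _ = let x , eq = complete p p≤d in x , keeps ext _ x eq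
        ... | inj₂ ()   | empty
        ... | inj₂ p≡1+d | snoc q e with complete q (≤-reflexive (suc-injective (trans (sym (len-∷ʳ q e)) p≡1+d)))
        ...   | y , eq with m≤n⇒m<n∨m≡n (proj₁ (sound _ y eq))
        ...     | inj₂ refl = expand-covers d fr dist [] c (proj₂ (frontier _) eq) e
        ...     | inj₁ y<d with proj₂ (sound _ y eq)
        ...       | q′ , _ , refl = let x , eq′ = complete (q′ ∷ʳ e) (subst (_≤ d) (sym (len-∷ʳ q′ e)) y<d)
                                    in x , keeps ext _ x eq′

    layersFrom-correct : ∀ f d fr dist c → n G < d + f → Invariant d fr dist →
                         let r = layersFrom f d fr dist c in Layers d (proj₁ r) × Exact (proj₁ (proj₂ r))
    layersFrom-correct zero d fr dist c n<d inv = far , Invariant-exact inv far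
      where
      far = Invariant-exhausted inv λ w w∈ →
              <⇒≱ (dist<n (proj₁ (Invariant-frontier inv w) w∈)) (<⇒≤ (subst (n G <_) (+-identityʳ d) n<d))
    layersFrom-correct (suc f) d [] dist c _ inv = far , Invariant-exact inv far
      where far = Invariant-exhausted inv λ _ ()
    layersFrom-correct (suc f) d (x ∷ xs) dist c n<d+f inv = (Invariant-frontier inv , proj₁ rest) , proj₂ rest
      where
      r = expand d (x ∷ xs) dist [] c
      rest = layersFrom-correct f (suc d) (proj₁ (proj₂ r)) (proj₁ r) (proj₂ (proj₂ r))
               (subst (n G <_) (+-suc d f) n<d+f) (Invariant-expand inv c)

    Invariant-source : Invariant 0 (v ∷ []) (sourceLabels v)
    Invariant-source = record { frontier = frontier ; sound = sound ; complete = complete }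
      where
      frontier : IsLabelLayer 0 (sourceLabels v) (v ∷ [])
      frontier w with w ≟ v
      ... | yes refl = (λ _ → refl) , (λ _ → here refl)
      ... | no  w≢v  = (λ { (here w≡v) → ⊥-elim (w≢v w≡v) }) , (λ ())

      sound : ∀ w x → sourceLabels v w ≡ just x → x ≤ 0 × IsDist w x
      sound w x eq with w ≟ v | eq
      ... | yes refl | refl = z≤n , dist-source

      complete : ∀ {w} (p : Path G v w) → len G p ≤ 0 → Marked (sourceLabels v) w
      complete here _ = 0 , upd-≡ _ v _

    bfs-correct : Layers 0 (proj₁ (bfs v)) × Exact (proj₁ (proj₂ (bfs v)))
    bfs-correct = layersFrom-correct (suc (n G)) 0 (v ∷ []) _ (n G) ≤-refl Invariant-source

  -- Least tallies along shortest paths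

  infix 4 _≤ᵐ_
  _≤ᵐ_ : Maybe ℕ → ℕ → Set
  mb ≤ᵐ a = MaybeAny (_≤ a) mb

  ≤ᵐ⇒≡just : ∀ {mb a} → mb ≤ᵐ a → Σ ℕ λ m → mb ≡ just m × m ≤ a
  ≤ᵐ⇒≡just (just m≤a) = _ , refl , m≤a

  ≤ᵐ-trans : ∀ {mb a b} → mb ≤ᵐ a → a ≤ b → mb ≤ᵐ b
  ≤ᵐ-trans (just m≤a) a≤b = just (≤-trans m≤a a≤b)

  ≤ᵐ-+ : ∀ {mb a} k → mb ≤ᵐ a → Maybe.map (_+ k) mb ≤ᵐ a + k
  ≤ᵐ-+ k (just m≤a) = just (+-monoˡ-≤ k m≤a)

  minM-sel : ∀ a b {m} → minM a b ≡ just m → a ≡ just m ⊎ b ≡ just m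
  minM-sel nothing  b        eq   = inj₂ eq
  minM-sel (just a) nothing  eq   = inj₁ eq
  minM-sel (just a) (just b) refl with ⊓-sel a b
  ... | inj₁ a⊓b≡a = inj₁ (cong just (sym a⊓b≡a))
  ... | inj₂ a⊓b≡b = inj₂ (cong just (sym a⊓b≡b))

  minM-≤ᵐˡ : ∀ a b {x} → a ≤ᵐ x → minM a b ≤ᵐ x
  minM-≤ᵐˡ (just a) nothing  a≤x        = a≤x
  minM-≤ᵐˡ (just a) (just b) (just a≤x) = just (≤-trans (m⊓n≤m a b) a≤x)

  minM-≤ᵐʳ : ∀ a b {x} → b ≤ᵐ x → minM a b ≤ᵐ x
  minM-≤ᵐʳ nothing  (just b) b≤x        = b≤x
  minM-≤ᵐʳ (just a) (just b) (just b≤x) = just (≤-trans (m⊓n≤n a b) b≤x)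

  module _ (dist : Labels) (d : ℕ) (val : Labels) where

    PredecessorWith : List V → ℕ → Set
    PredecessorWith us m = Σ V λ u → u ∈ us × dist u ≡ just d × val u ≡ just m

    later : ∀ {u us m} → PredecessorWith us m → PredecessorWith (u ∷ us) m
    later (u , u∈ , du , vu) = u , there u∈ , du , vu

    -- the test does (e ≟ d) in bestPred computes to e ≡ᵇ d, which is what the proofs below split on
    bestPred-sel : ∀ us acc c {m} → proj₁ (bestPred dist d val us acc c) ≡ just m →
                   acc ≡ just m ⊎ PredecessorWith us m
    bestPred-sel []       acc c eq = inj₁ eq
    bestPred-sel (u ∷ us) acc c eq with dist u in du
    ... | nothing = Sum.map₂ later (bestPred-sel us acc (suc c) eq)
    ... | just e with e ≡ᵇ d | ≡ᵇ⇒≡ e d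
    ...   | false | _   = Sum.map₂ later (bestPred-sel us acc (suc c) eq)
    ...   | true  | e≡d with bestPred-sel us (minM acc (val u)) (suc c) eq
    ...     | inj₂ found = inj₂ (later found)
    ...     | inj₁ min≡ with minM-sel acc (val u) min≡
    ...       | inj₁ acc≡ = inj₁ acc≡
    ...       | inj₂ val≡ = inj₂ (u , here refl , trans du (cong just (e≡d _)) , val≡)

    bestPred-≤ᵐ-acc : ∀ us acc c {a} → acc ≤ᵐ a → proj₁ (bestPred dist d val us acc c) ≤ᵐ a
    bestPred-≤ᵐ-acc []       acc c acc≤a = acc≤a
    bestPred-≤ᵐ-acc (u ∷ us) acc c acc≤a with dist u
    ... | nothing = bestPred-≤ᵐ-acc us acc (suc c) acc≤a
    ... | just e with e ≡ᵇ d
    ...   | false = bestPred-≤ᵐ-acc us acc (suc c) acc≤a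
    ...   | true  = bestPred-≤ᵐ-acc us (minM acc (val u)) (suc c) (minM-≤ᵐˡ acc (val u) acc≤a)

    bestPred-≤ᵐ : ∀ us acc c {u a} → u ∈ us → dist u ≡ just d → val u ≤ᵐ a →
                  proj₁ (bestPred dist d val us acc c) ≤ᵐ a
    bestPred-≤ᵐ (u ∷ us) acc c (here refl) du vu≤a with dist u | du
    ... | just e | refl with e ≡ᵇ e | ≡⇒≡ᵇ e e refl
    ...   | true | _ = bestPred-≤ᵐ-acc us (minM acc (val u)) (suc c) (minM-≤ᵐʳ acc (val u) vu≤a)
    bestPred-≤ᵐ (u ∷ us) acc c (there u′∈) du′ vu′≤a with dist u
    ... | nothing = bestPred-≤ᵐ us acc (suc c) u′∈ du′ vu′≤a
    ... | just e with e ≡ᵇ d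
    ...   | false = bestPred-≤ᵐ us acc (suc c) u′∈ du′ vu′≤a
    ...   | true  = bestPred-≤ᵐ us (minM acc (val u)) (suc c) u′∈ du′ vu′≤a

  module MinTally (v : V) (χ : V → ℕ) (dist : Labels) (exact : Distances.Exact v dist) where
    open Distances v

    Witnessed : Labels → Set
    Witnessed val = ∀ w m → val w ≡ just m → Σ (Path G v w) λ p → IsShortest G p × tally χ p ≤ m

    LowerBoundAt : Labels → V → Set
    LowerBoundAt val w = ∀ (p : Path G v w) → IsShortest G p → val w ≤ᵐ tally χ p

    LowerBoundUpTo : ℕ → Labels → Set
    LowerBoundUpTo d val = ∀ w e → e ≤ d → IsDist w e → LowerBoundAt val w

    relax : ℕ → Labels → ℕ → V → Labels
    relax d val c w = upd val w (Maybe.map (_+ χ w) (proj₁ (bestPred dist d val (adj G w) nothing (suc c))))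

    relax-keeps : ∀ {d val c w w′} → w′ ≢ w → LowerBoundAt val w′ → LowerBoundAt (relax d val c w) w′
    relax-keeps {val = val} {w = w} {w′} w′≢w low p sp =
      subst (_≤ᵐ tally χ p) (sym (upd-≢ val w _ w′ w′≢w)) (low p sp)

    module _ {d val} (c : ℕ) {w} (dw : IsDist w (suc d)) (wit : Witnessed val) (low : LowerBoundUpTo d val) where
      private
        best = proj₁ (bestPred dist d val (adj G w) nothing (suc c))

      best-witnessed : ∀ {m} → best ≡ just m → Σ (Path G v w) λ p → IsShortest G p × tally χ p ≤ m + χ w
      best-witnessed eq with bestPred-sel dist d val (adj G w) nothing (suc c) eq
      ... | inj₂ (u , w∈adj , du , vu) with wit u _ vu
      ...   | p , sp , tp = p ∷ʳ e , dist-shortest dw (p ∷ʳ e) (trans (len-∷ʳ p e) (cong suc len-p))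
                          , subst (_≤ _) (sym (tally-∷ʳ χ p e)) (+-monoˡ-≤ (χ w) tp)
        where
        e = Graph.sym G w u w∈adj
        len-p = dist-unique (p , sp , refl) (proj₁ (exact u d) du)

      relax-witnessed : Witnessed (relax d val c w)
      relax-witnessed w′ m eq with w′ ≟ w
      ... | no  _    = wit w′ m eq
      ... | yes refl with best in eb | eq
      ...   | just _ | refl = best-witnessed eb

      relax-lowerBound : LowerBoundAt (relax d val c w) w
      relax-lowerBound p sp = subst (_≤ᵐ tally χ p) (sym (upd-≡ val w _)) (lower p sp)
        where
        lower : (p : Path G v w) → IsShortest G p → Maybe.map (_+ χ w) best ≤ᵐ tally χ p
        lower p sp with snocView p | dist-unique (p , sp , refl) dw
        ... | empty    | ()
        ... | snoc q e | len≡ = subst (_ ≤ᵐ_) (sym (tally-∷ʳ χ q e)) (≤ᵐ-+ (χ w)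
                (bestPred-≤ᵐ dist d val (adj G w) nothing (suc c) (Graph.sym G _ w e) (proj₂ (exact _ d) dq)
                             (low _ d ≤-refl dq q sq)))
          where
          sq = shortest-init q e sp
          dq = q , sq , suc-injective (trans (sym (len-∷ʳ q e)) len≡)

    processLayer-correct : ∀ d l val c → (∀ w → w ∈ l → IsDist w (suc d)) →
      Witnessed val → LowerBoundUpTo d val →
      let val′ = proj₁ (processLayer dist χ d l val c) in
      Witnessed val′ × LowerBoundUpTo d val′ ×
      (∀ w → IsDist w (suc d) → LowerBoundAt val w ⊎ w ∈ l → LowerBoundAt val′ w)
    processLayer-correct d []        val c _   wit low = wit , low , λ { _ _ (inj₁ lb) → lb ; _ _ (inj₂ ()) }
    processLayer-correct d (w₀ ∷ ws) val c inl wit low = proj₁ rest , proj₁ (proj₂ rest) , layer′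
      where
      dw₀ = inl w₀ (here refl)

      low₀ : LowerBoundUpTo d (relax d val c w₀)
      low₀ w e e≤d dw =
        relax-keeps (λ { refl → 1+n≰n (subst (_≤ d) (dist-unique dw dw₀) e≤d) }) (low w e e≤d dw)

      rest = processLayer-correct d ws (relax d val c w₀) (proj₂ (bestPred dist d val (adj G w₀) nothing (suc c)))
               (λ w w∈ → inl w (there w∈)) (relax-witnessed c dw₀ wit low) low₀

      layer′ : ∀ w → IsDist w (suc d) → LowerBoundAt val w ⊎ w ∈ w₀ ∷ ws →
               LowerBoundAt (proj₁ (processLayer dist χ d (w₀ ∷ ws) val c)) w
      layer′ w dw (inj₂ (there w∈))  = proj₂ (proj₂ rest) w dw (inj₂ w∈)
      layer′ w dw (inj₂ (here refl)) = proj₂ (proj₂ rest) w dw (inj₁ (relax-lowerBound c dw₀ wit low))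
      layer′ w dw (inj₁ lb) with w ≟ w₀
      ... | yes refl = proj₂ (proj₂ rest) w dw (inj₁ (relax-lowerBound c dw₀ wit low))
      ... | no  w≢w₀ = proj₂ (proj₂ rest) w dw (inj₁ (relax-keeps w≢w₀ lb))

    processLayers-correct : ∀ d ls val c → Layers (suc d) ls → Witnessed val → LowerBoundUpTo d val →
      let val′ = proj₁ (processLayers dist χ d ls val c) in Witnessed val′ × (∀ w → LowerBoundAt val′ w)
    processLayers-correct d [] val c none wit low = wit , λ w p sp → low w (len G p) (len≤ p sp) (p , sp , refl) p sp
      where
      len≤ : ∀ {w} (p : Path G v w) → IsShortest G p → len G p ≤ d
      len≤ p sp with len G p ≤? d
      ... | yes p≤d = p≤d
      ... | no  p≰d = ⊥-elim (none _ (len G p) (≰⇒> p≰d) (p , sp , refl))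
    processLayers-correct d (l ∷ ls) val c (layer , layers) wit low
      with processLayer-correct d l val c (λ w → proj₁ (layer w)) wit low
    ... | wit′ , low′ , layer′ = processLayers-correct (suc d) ls _ _ layers wit′ low″
      where
      low″ : LowerBoundUpTo (suc d) _
      low″ w e e≤1+d dw with m≤n⇒m<n∨m≡n e≤1+d
      ... | inj₁ (s≤s e≤d) = low′ w e e≤d dw
      ... | inj₂ refl      = layer′ w dw (inj₂ (proj₂ (layer w) dw))

    Witnessed-source : Witnessed (sourceLabels v)
    Witnessed-source w m eq with w ≟ v | eq
    ... | yes refl | refl = here , (λ _ → z≤n) , z≤n

    LowerBoundUpTo-source : LowerBoundUpTo 0 (sourceLabels v)
    LowerBoundUpTo-source w .0 z≤n dw with dist0⇒≡v dw
    ... | refl = λ p _ → subst (_≤ᵐ tally χ p) (sym (upd-≡ _ v (just 0))) (just z≤n)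

  -- Correctness and cost of MkV

  open DecMem (_≟_ {n = n G}) using (_∈?_)

  inSArr-does : ∀ S w → proj₁ (inSArr S) w ≡ does (w ∈? S)
  inSArr-does []       w = refl
  inSArr-does (s ∷ ss) w with w ≟ s
  ... | yes _ = refl
  ... | no  _ = inSArr-does ss w

  indicator : List V → V → ℕ
  indicator S w = if does (w ∈? S) then 1 else 0

  countIn-∷ : ∀ S x xs → countIn G S (x ∷ xs) ≡ indicator S x + countIn G S xs
  countIn-∷ S x xs with does (x ∈? S)
  ... | true  = refl
  ... | false = refl

  module Counting (S : List V) (v : V) where

    -- the vertex weight that fromVertex passes to processLayers, verbatim
    χ : V → ℕ
    χ w = if proj₁ (inSArr S) w ∧ not (does (w ≟ v)) then 1 else 0

    χ≡indicator : ∀ w → w ≢ v → χ w ≡ indicator S w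
    χ≡indicator w w≢v with w ≟ v
    ... | yes w≡v = ⊥-elim (w≢v w≡v)
    ... | no  _ rewrite inSArr-does S w with does (w ∈? S)
    ...   | true  = refl
    ...   | false = refl

    tally-countIn : ∀ {u x q} (e : x ∈ adj G u) (p : Path G x q) → (∀ j → vertexAt p j ≢ v) →
                    tally χ (step e p) ≡ countIn G S (internal G (step e p)) + indicator S q
    tally-countIn {q = q} e here avoids = trans (+-identityʳ _) (χ≡indicator q (avoids fzero))
    tally-countIn {x = x} {q = q} e (step e′ p) avoids = begin
      χ x + tally χ (step e′ p)                             ≡⟨ cong₂ _+_ (χ≡indicator x (avoids fzero))
                                                                         (tally-countIn e′ p (avoids ∘ fsuc)) ⟩
      indicator S x + (countIn G S int + indicator S q)     ≡⟨ +-assoc (indicator S x) _ _ ⟨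
      indicator S x + countIn G S int + indicator S q       ≡⟨ cong (_+ indicator S q) (countIn-∷ S x int) ⟨
      countIn G S (x ∷ int) + indicator S q                 ∎
      where
      open ≡-Reasoning
      int = internal G (step e′ p)

    tally-visible : ∀ {q} (p : Path G v q) → IsShortest G p → q ∈ S → q ≢ v →
                    tally χ p ≡ countIn G S (internal G p) + 1
    tally-visible here             _  _   q≢v = ⊥-elim (q≢v refl)
    tally-visible {q} (step e p) sp q∈S _   = begin
      tally χ (step e p)                                   ≡⟨ tally-countIn e p avoids ⟩
      countIn G S (internal G (step e p)) + indicator S q  ≡⟨ cong (countIn G S (internal G (step e p)) +_) (indicator-∈ q∈S) ⟩
      countIn G S (internal G (step e p)) + 1              ∎
      where
      open ≡-Reasoning
      avoids : ∀ j → vertexAt p j ≢ v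
      avoids j pⱼ≡v = shortest-simple (step e p) sp fzero (fsuc j) (s≤s z≤n) (sym pⱼ≡v)
      indicator-∈ : q ∈ S → indicator S q ≡ 1
      indicator-∈ q∈S with q ∈? S
      ... | yes _   = refl
      ... | no  q∉S = ⊥-elim (q∉S q∈S)

  checkVals-sound : ∀ v k val qs c → T (proj₁ (checkVals v k val qs c)) →
                    ∀ q → q ∈ qs → q ≢ v → val q ≤ᵐ suc k
  checkVals-sound v k val (q ∷ qs) c t .q (here refl) q≢v with q ≟ v
  ... | yes q≡v = ⊥-elim (q≢v q≡v)
  ... | no  _ with val q
  ...   | nothing = ⊥-elim t
  ...   | just x  = just (≤ᵇ⇒≤ x (suc k) (proj₁ (Equivalence.to T-∧ t)))
  checkVals-sound v k val (q ∷ qs) c t q′ (there q′∈) q′≢v with q ≟ v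
  ... | yes _ = checkVals-sound v k val qs (suc c) t q′ q′∈ q′≢v
  ... | no  _ with val q
  ...   | nothing = ⊥-elim t
  ...   | just _  = checkVals-sound v k val qs (suc c) (proj₂ (Equivalence.to T-∧ t)) q′ q′∈ q′≢v

  checkVals-complete : ∀ v k val qs c → (∀ q → q ∈ qs → q ≢ v → val q ≤ᵐ suc k) →
                       T (proj₁ (checkVals v k val qs c))
  checkVals-complete v k val []       c _  = _
  checkVals-complete v k val (q ∷ qs) c ok with q ≟ v
  ... | yes _   = checkVals-complete v k val qs (suc c) (λ q′ → ok q′ ∘ there)
  ... | no  q≢v with val q | ok q (here refl) q≢v
  ...   | just x | just x≤ = Equivalence.from T-∧ (≤⇒≤ᵇ x≤ , checkVals-complete v k val qs (suc c) (λ q′ → ok q′ ∘ there))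

  fromVertex-correct : ∀ S k v → T (proj₁ (fromVertex (proj₁ (inSArr S)) S k v)) ⇔
                                 (∀ q → q ∈ S → q ≢ v → Visible G S k v q)
  fromVertex-correct S k v = mk⇔
    (λ t q q∈ q≢v → visible q∈ q≢v (checkVals-sound v k val S _ t q q∈ q≢v))
    (λ vis → checkVals-complete v k val S _ λ q q∈ q≢v → bounded q∈ q≢v (vis q q∈ q≢v))
    where
    open Counting S v
    r = bfs v
    layers-ok = proj₁ (BFS.bfs-correct v)
    open MinTally v χ (proj₁ (proj₂ r)) (proj₂ (BFS.bfs-correct v))
    result = processLayers-correct 0 (drop 1 (proj₁ r)) (sourceLabels v) (proj₂ (proj₂ r) + n G)
               (proj₂ layers-ok) Witnessed-source LowerBoundUpTo-source
    val = proj₁ (processLayers (proj₁ (proj₂ r)) χ 0 (drop 1 (proj₁ r)) (sourceLabels v)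
                               (proj₂ (proj₂ r) + n G))

    visible : ∀ {q} → q ∈ S → q ≢ v → val q ≤ᵐ suc k → Visible G S k v q
    visible {q} q∈ q≢v val≤ with ≤ᵐ⇒≡just val≤
    ... | m , eq , m≤ with proj₁ result q m eq
    ...   | p , sp , tp =
      p , sp , ≤-pred (subst (_≤ suc k) (trans (tally-visible p sp q∈ q≢v) (+-comm _ 1)) (≤-trans tp m≤))

    bounded : ∀ {q} → q ∈ S → q ≢ v → Visible G S k v q → val q ≤ᵐ suc k
    bounded {q} q∈ q≢v (p , sp , cnt≤k) = ≤ᵐ-trans (proj₂ result q p sp)
      (subst (_≤ suc k) (sym (trans (tally-visible p sp q∈ q≢v) (+-comm _ 1))) (s≤s cnt≤k))

  allFrom-correct : ∀ inS S k vs → T (proj₁ (allFrom inS S k vs)) ⇔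
                                   (∀ v → v ∈ vs → T (proj₁ (fromVertex inS S k v)))
  allFrom-correct inS S k []       = mk⇔ (λ _ _ ()) (λ _ → _)
  allFrom-correct inS S k (u ∷ us) = mk⇔
    (λ t → let tu , tus = Equivalence.to T-∧ t in
           λ { _ (here refl) → tu ; v (there v∈) → Equivalence.to rest tus v v∈ })
    (λ all → Equivalence.from T-∧ (all u (here refl) , Equivalence.from rest (λ v → all v ∘ there)))
    where rest = allFrom-correct inS S k us

  allReached-complete : ∀ dist qs c → (∀ q → q ∈ qs → Marked dist q) → T (proj₁ (allReached dist qs c))
  allReached-complete dist []       c _      = _
  allReached-complete dist (q ∷ qs) c marked with dist q | marked q (here refl)
  ... | just _ | _ = allReached-complete dist qs (suc c) (λ q′ q′∈ → marked q′ (there q′∈))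

  mkv-correct : ∀ S k → T (proj₁ (MkV G S k)) ⇔ MutualKVisible G S k
  mkv-correct []        k = mk⇔ (λ _ _ _ ()) (λ _ → _)
  mkv-correct (s₀ ∷ ss) k with allReached (proj₁ (proj₂ (bfs s₀))) (s₀ ∷ ss) (proj₂ (proj₂ (bfs s₀))) in eq
  ... | false , _ = mk⇔ ⊥-elim λ mkv → subst (T ∘ proj₁) eq (allReached-complete _ (s₀ ∷ ss) _ (reached mkv))
    where
    open Distances s₀
    exact = proj₂ (BFS.bfs-correct s₀)
    reached : MutualKVisible G (s₀ ∷ ss) k → ∀ q → q ∈ s₀ ∷ ss → Marked (proj₁ (proj₂ (bfs s₀))) q
    reached mkv q q∈ with q ≟ s₀
    ... | yes refl = 0 , proj₂ (exact q 0) dist-source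
    ... | no  q≢s₀ with mkv s₀ q (here refl) q∈ (q≢s₀ ∘ sym)
    ...   | p , sp , _ = len G p , proj₂ (exact q (len G p)) (p , sp , refl)
  ... | true , _ = mk⇔
    (λ t u w u∈ w∈ u≢w → Equivalence.to (fromVertex-correct S k u)
                           (Equivalence.to (allFrom-correct inS S k S) t u u∈) w w∈ (u≢w ∘ sym))
    (λ mkv → Equivalence.from (allFrom-correct inS S k S) λ u u∈ →
               Equivalence.from (fromVertex-correct S k u) λ w w∈ w≢u → mkv u w u∈ w∈ (w≢u ∘ sym))
    where
    S = s₀ ∷ ss
    inS = proj₁ (inSArr S)

  bestPred-cost : ∀ dist d val us acc c → proj₂ (bestPred dist d val us acc c) ≡ c + length us
  bestPred-cost dist d val []       acc c = sym (+-identityʳ c)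
  bestPred-cost dist d val (u ∷ us) acc c with dist u
  ... | just _  = trans (bestPred-cost dist d val us _ (suc c)) (sym (+-suc c _))
  ... | nothing = trans (bestPred-cost dist d val us _ (suc c)) (sym (+-suc c _))

  processLayer-cost : ∀ dist χ d l val c → proj₂ (processLayer dist χ d l val c) ≡ c + weights l
  processLayer-cost dist χ d []       val c = sym (+-identityʳ c)
  processLayer-cost dist χ d (w ∷ ws) val c =
    trans (processLayer-cost dist χ d ws _ _)
          (trans (cong (_+ weights ws) (bestPred-cost dist d val (adj G w) nothing (suc c))) (suc-+-assoc c (deg w) _))

  processLayers-cost : ∀ dist χ d ls val c → proj₂ (processLayers dist χ d ls val c) ≡ c + layersWeight ls
  processLayers-cost dist χ d []       val c = sym (+-identityʳ c)
  processLayers-cost dist χ d (l ∷ ls) val c =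
    trans (processLayers-cost dist χ (suc d) ls _ _)
          (trans (cong (_+ layersWeight ls) (processLayer-cost dist χ d l val c)) (+-assoc c _ _))

  checkVals-cost : ∀ v k val qs c → proj₂ (checkVals v k val qs c) ≡ c + length qs
  checkVals-cost v k val []       c = sym (+-identityʳ c)
  checkVals-cost v k val (q ∷ qs) c = trans (checkVals-cost v k val qs (suc c)) (sym (+-suc c _))

  allReached-cost : ∀ dist qs c → proj₂ (allReached dist qs c) ≡ c + length qs
  allReached-cost dist []       c = sym (+-identityʳ c)
  allReached-cost dist (q ∷ qs) c = trans (allReached-cost dist qs (suc c)) (sym (+-suc c _))

  inSArr-cost : ∀ S → proj₂ (inSArr S) ≡ n G + length S
  inSArr-cost []       = sym (+-identityʳ (n G))
  inSArr-cost (s ∷ ss) = trans (cong suc (inSArr-cost ss)) (sym (+-suc (n G) _))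

  fromVertex-cost : ∀ inS S k v → let B = n G + degSum G in
                    proj₂ (fromVertex inS S k v) ≤ n G + B + n G + B + length S
  fromVertex-cost inS S k v = begin
    proj₂ (fromVertex inS S k v)                                ≡⟨ checkVals-cost v k _ S _ ⟩
    proj₂ (processLayers dist _ 0 ls _ (c + n G)) + length S    ≡⟨ cong (_+ length S) (processLayers-cost dist _ 0 ls _ _) ⟩
    c + n G + layersWeight ls + length S                        ≤⟨ +-monoˡ-≤ (length S) (+-mono-≤ (+-monoˡ-≤ (n G) (bfs-cost v)) ls≤) ⟩
    n G + (n G + degSum G) + n G + (n G + degSum G) + length S  ∎
    where
    open ≤-Reasoning
    r = bfs v
    dist = proj₁ (proj₂ r)
    c = proj₂ (proj₂ r)
    ls = drop 1 (proj₁ r)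
    ls≤ : layersWeight ls ≤ n G + degSum G
    ls≤ = ≤-trans (m≤n+m _ (weights (v ∷ []))) (bfs-layersWeight v)

  allFrom-cost : ∀ inS S k vs b → (∀ v → proj₂ (fromVertex inS S k v) ≤ b) →
                 proj₂ (allFrom inS S k vs) ≤ length vs * b
  allFrom-cost inS S k []       b _     = z≤n
  allFrom-cost inS S k (u ∷ us) b bound = +-mono-≤ (bound u) (allFrom-cost inS S k us b bound)

  allReached-bfs-cost : ∀ s₀ S → let r = bfs s₀ in
                        proj₂ (allReached (proj₁ (proj₂ r)) S (proj₂ (proj₂ r))) ≤ n G + (n G + degSum G) + length S
  allReached-bfs-cost s₀ S = subst (_≤ n G + (n G + degSum G) + length S) (sym (allReached-cost _ S _))
                                   (+-monoˡ-≤ (length S) (bfs-cost s₀))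

  mkv-cost : ∀ S k → proj₂ (MkV G S k) ≤ 7 * (length S * (n G + degSum G) + length S * length S)
  mkv-cost []        k = z≤n
  mkv-cost S@(s₀ ∷ ss) k with allReached (proj₁ (proj₂ (bfs s₀))) S (proj₂ (proj₂ (bfs s₀))) in eq
  ... | false , c₁ = ≤-trans c₁≤ (≤-trans (≤-trans (m≤m+n _ _) (m≤m+n _ _))
                                          (cost-arithmetic (n G) (degSum G) (length ss)))
    where c₁≤ = subst (_≤ n G + (n G + degSum G) + length S) (cong proj₂ eq) (allReached-bfs-cost s₀ S)
  ... | true , c₁ = ≤-trans (+-mono-≤ (+-mono-≤ c₁≤ (≤-reflexive (inSArr-cost S)))
                                      (allFrom-cost (proj₁ (inSArr S)) S k S _ (fromVertex-cost (proj₁ (inSArr S)) S k)))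
                            (cost-arithmetic (n G) (degSum G) (length ss))
    where c₁≤ = subst (_≤ n G + (n G + degSum G) + length S) (cong proj₂ eq) (allReached-bfs-cost s₀ S)

theorem6p2 : Σ ℕ λ c → ∀ (G : Graph) (S : List (Fin (n G))) (k : ℕ) → Unique S →
    (T (proj₁ (MkV G S k)) ⇔ MutualKVisible G S k)
    × proj₂ (MkV G S k) ≤ c * (length S * (n G + degSum G) + length S * length S)
theorem6p2 = 7 , λ G S k _ → mkv-correct G S k , mkv-cost G S k
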